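{- Let $v\ge1$, $k\ge1$, $0\le t\le k$ be integers and let $M=M_t(v,k)$ be the $t$-inclusion matrix defined in the context, over the reals, with $C_{\mathbf y}$ denoting its column indexed by $\mathbf y\in V^k$. For every $\mathbf x=(x_1,\ldots,x_k)\in V^k$ with $L_{\mathbf x}>t$, \[ \sum_{\mathbf y\in F_{\mathbf x}}(-1)^{L_{\mathbf y}}C_{\mathbf y}=\mathbf 0, \] where $\mathbf 0$ is the zero vector.
   Context: Let $V=\{0,1,\ldots,v-1\}$ and $V^k$ the set of ordered $k$-tuples of elements of $V$. For a $t$-subset $I=\{i_1<\cdots<i_t\}$ of $\{1,\ldots,k\}$, let $V^t_I=\{(u_1,\ldots,u_t)_I : u_j\in V\}$. Say $(u_1,\ldots,u_t)_I\in(x_1,\ldots,x_k)$ iff $u_j=x_{i_j}$ for all $j$. The matrix $M_t(v,k)$ has columns indexed by $V^k$, rows indexed by $\bigcup_I V^t_I$ over all $t$-subsets $I$ of $\{1,\ldots,k\}$, and entry $1$ in row $(u_1,\ldots,u_t)_I$, column $\mathbf x$ iff $(u_1,\ldots,u_t)_I\in\mathbf x$, and $0$ otherwise. For $\mathbf x\in V^k$: $F_{\mathbf x}=\{(z_1,\ldots,z_k): z_i\in\{0,x_i\}\text{ for all } i\}$, $A_{\mathbf x}=\{i: x_i\neq0\}$, and $L_{\mathbf x}=|A_{\mathbf x}|$. -}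

module Defs where

open import Data.Nat using (ℕ; zero; suc)
open import Data.Fin using (Fin; zero; suc; _<_; _≟_)
open import Data.Fin.Properties using (all?)
open import Data.Vec using (Vec; []; _∷_; lookup; count)
open import Data.List using (List; []; _∷_; map; concatMap; foldr)
open import Data.Integer using (ℤ; _+_; _*_; -1ℤ; 0ℤ; 1ℤ; _^_)
open import Data.Sum using (_⊎_)
open import Data.Bool using (if_then_else_)
open import Relation.Nullary using (Dec; does; ¬?; _⊎-dec_)
open import Relation.Binary.PropositionalEquality using (_≡_)

-- Convention: v = suc w (so v ≥ 1), V = Fin v, the element 0 of V is Fin.zero.
V : ℕ → Set
V v = Fin v

Tuple : ℕ → ℕ → Set
Tuple v k = Vec (V v) k

allFinL : (v : ℕ) → List (Fin v)
allFinL zero = []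
allFinL (suc v) = zero ∷ map suc (allFinL v)

allTuples : (v k : ℕ) → List (Tuple v k)
allTuples v zero = [] ∷ []
allTuples v (suc k) =
  concatMap (λ a → map (a ∷_) (allTuples v k)) (allFinL v)

sumL : {A : Set} → List A → (A → ℤ) → ℤ
sumL xs f = foldr (λ a s → f a + s) 0ℤ xs

-- A row index (u_1,…,u_t)_I : I = {i_1 < … < i_t} ⊆ {1,…,k} given by a
-- strictly increasing map ι : Fin t → Fin k (ι j = i_j), and u : Fin t → V.
record Row (v k t : ℕ) : Set where
  field
    ι     : Fin t → Fin k
    ι-inc : ∀ (a b : Fin t) → a < b → ι a < ι b
    u     : Fin t → V v
open Row public

_∈Row_ : {v k t : ℕ} → Row v k t → Tuple v k → Set
r ∈Row x = ∀ j → u r j ≡ lookup x (ι r j)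

_∈Row?_ : {v k t : ℕ} → (r : Row v k t) → (x : Tuple v k) → Dec (r ∈Row x)
r ∈Row? x = all? (λ j → u r j ≟ lookup x (ι r j))

-- The t-inclusion matrix M_t(v,k) (entries in ℤ ⊆ ℝ).
M : (v k t : ℕ) → Row v k t → Tuple v k → ℤ
M v k t r x = if does (r ∈Row? x) then 1ℤ else 0ℤ

C : {v k t : ℕ} → Tuple v k → Row v k t → ℤ
C {v} {k} {t} y r = M v k t r y

_∈F_ : {w k : ℕ} → Tuple (suc w) k → Tuple (suc w) k → Set
z ∈F x = ∀ i → (lookup z i ≡ zero) ⊎ (lookup z i ≡ lookup x i)

_∈F?_ : {w k : ℕ} → (z x : Tuple (suc w) k) → Dec (z ∈F x)
z ∈F? x = all? (λ i → (lookup z i ≟ zero) ⊎-dec (lookup z i ≟ lookup x i))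

L : {w k : ℕ} → Tuple (suc w) k → ℕ
L x = count (λ a → ¬? (a ≟ zero)) x

-- Coordinate r of the vector  Σ_{y ∈ F_x} (-1)^{L_y} C_y.
signedSumF : (w k t : ℕ) → Tuple (suc w) k → Row (suc w) k t → ℤ
signedSumF w k t x r =
  sumL (allTuples (suc w) k)
    (λ y → if does (y ∈F? x) then (-1ℤ ^ L y) * C y r else 0ℤ)

module Submission where

-- Fix a row (u_1,…,u_t)_I.  Since the support A_x of x has more than t = |I|
-- elements, some coordinate i lies in A_x but not in I (a counting argument
-- with finite subsets of Fin k).  Group the tuples y ∈ V^k into the fibres
-- { y[i≔a] : a ∈ V } obtained by varying the i-th coordinate.  Within a fibre
-- only a = 0 and a = x_i give tuples in F_x; these two tuples either both lie
-- in F_x or both do not, they have the same entry in the row (the row does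
-- not look at coordinate i ∉ I), and their L-values differ by one.  Hence
-- every fibre sum is 0, and so is the total sum.

open import Defs
open import Data.Nat using (ℕ; suc; _≤_; _<_)
open import Data.Integer using (0ℤ)
open import Relation.Binary.PropositionalEquality using (_≡_)

import Data.Nat as ℕ
open import Data.Nat using (z≤n; s≤s)
open import Data.Nat.Properties using (<⇒≱; +-suc; m≤n⇒m≤1+n; ≤-reflexive; ≤-trans; ≤-<-trans; +-mono-≤)
open import Data.Fin using (Fin; zero; suc; _≟_)
open import Data.Fin.Properties using (any?; suc-injective)
open import Data.Fin.Subset using (Subset; inside; outside; _∈_; _∉_; _⊆_; _∪_; ⁅_⁆; ∣_∣)
  renaming (⊥ to ∅)
open import Data.Fin.Subset.Properties using (_∈?_; p⊆q⇒∣p∣≤∣q∣; x∈p∪q⁺; x∈⁅x⁆; ∣⁅x⁆∣≡1; ∣⊥∣≡0)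
open import Data.Vec using (Vec; []; _∷_; lookup; count; _[_]≔_; there)
open import Data.Vec.Properties using (lookup∘update; lookup∘update′)
open import Data.List using (List; []; _∷_; map; concatMap; _++_)
open import Data.Integer using (ℤ; _+_; _*_; 1ℤ; -1ℤ; _^_; -_)
open import Data.Integer.Properties using (+-identityˡ; +-identityʳ; +-assoc; -1*i≡-i; neg-distribˡ-*; +-inverseʳ; +-commutativeSemigroup)
open import Algebra.Properties.CommutativeSemigroup +-commutativeSemigroup using (interchange)
open import Data.Bool using (Bool; true; false; if_then_else_)
open import Data.Sum using (_⊎_; inj₁; inj₂; [_,_])
open import Data.Product using (∃; _×_; _,_)
open import Function.Base using (_∘_)
open import Function.Bundles using (mk⇔)
open import Relation.Nullary using (yes; no; does; ¬_; ¬?; contradiction; _×-dec_)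
open import Relation.Nullary.Decidable using (dec-false; does-⇔; decidable-stable)
open import Relation.Unary using (Decidable)
open import Relation.Binary.PropositionalEquality using (_≢_; refl; sym; trans; cong; cong₂; subst)
open Relation.Binary.PropositionalEquality.≡-Reasoning

sumL-++ : {A : Set} (xs ys : List A) (f : A → ℤ) →
  sumL (xs ++ ys) f ≡ sumL xs f + sumL ys f
sumL-++ []       ys f = sym (+-identityˡ _)
sumL-++ (x ∷ xs) ys f =
  trans (cong (f x +_) (sumL-++ xs ys f)) (sym (+-assoc (f x) _ _))

sumL-map : {A B : Set} (g : A → B) (xs : List A) (f : B → ℤ) →
  sumL (map g xs) f ≡ sumL xs (f ∘ g)
sumL-map g []       f = refl
sumL-map g (x ∷ xs) f = cong (f (g x) +_) (sumL-map g xs f)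

sumL-concatMap : {A B : Set} (h : A → List B) (xs : List A) (f : B → ℤ) →
  sumL (concatMap h xs) f ≡ sumL xs (λ a → sumL (h a) f)
sumL-concatMap h []       f = refl
sumL-concatMap h (x ∷ xs) f =
  trans (sumL-++ (h x) (concatMap h xs) f) (cong (sumL (h x) f +_) (sumL-concatMap h xs f))

sumL-cong : {A : Set} (xs : List A) {f g : A → ℤ} → (∀ a → f a ≡ g a) → sumL xs f ≡ sumL xs g
sumL-cong []       f≗g = refl
sumL-cong (x ∷ xs) f≗g = cong₂ _+_ (f≗g x) (sumL-cong xs f≗g)

sumL-vanishes : {A : Set} (xs : List A) {f : A → ℤ} → (∀ a → f a ≡ 0ℤ) → sumL xs f ≡ 0ℤ
sumL-vanishes []       f≗0 = refl
sumL-vanishes (x ∷ xs) f≗0 = cong₂ _+_ (f≗0 x) (sumL-vanishes xs f≗0)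

sumL-+ : {A : Set} (xs : List A) (f g : A → ℤ) →
  sumL xs (λ a → f a + g a) ≡ sumL xs f + sumL xs g
sumL-+ []       f g = refl
sumL-+ (x ∷ xs) f g =
  trans (cong ((f x + g x) +_) (sumL-+ xs f g)) (interchange (f x) (g x) _ _)

sumL-swap : {A B : Set} (xs : List A) (ys : List B) (f : A → B → ℤ) →
  sumL xs (λ a → sumL ys (f a)) ≡ sumL ys (λ b → sumL xs (λ a → f a b))
sumL-swap []       ys f = sym (sumL-vanishes ys (λ _ → refl))
sumL-swap (x ∷ xs) ys f =
  trans (cong (sumL ys (f x) +_) (sumL-swap xs ys f))
        (sym (sumL-+ ys (f x) (λ b → sumL xs (λ a → f a b))))

sum-allFin-suc : {v : ℕ} (h : Fin (suc v) → ℤ) →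
  sumL (allFinL (suc v)) h ≡ h zero + sumL (allFinL v) (h ∘ suc)
sum-allFin-suc {v} h = cong (h zero +_) (sumL-map suc (allFinL v) h)

sum-single-point : {v : ℕ} (p : Fin v) (h : Fin v → ℤ) →
  (∀ a → a ≢ p → h a ≡ 0ℤ) → sumL (allFinL v) h ≡ h p
sum-single-point {suc v} zero h off-p = begin
  sumL (allFinL (suc v)) h                  ≡⟨ sum-allFin-suc h ⟩
  h zero + sumL (allFinL v) (h ∘ suc)       ≡⟨ cong (h zero +_) (sumL-vanishes (allFinL v) (λ a → off-p (suc a) (λ ()))) ⟩
  h zero + 0ℤ                               ≡⟨ +-identityʳ (h zero) ⟩
  h zero                                    ∎
sum-single-point {suc v} (suc p) h off-p = begin
  sumL (allFinL (suc v)) h                  ≡⟨ sum-allFin-suc h ⟩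
  h zero + sumL (allFinL v) (h ∘ suc)       ≡⟨ cong (_+ sumL (allFinL v) (h ∘ suc)) (off-p zero (λ ())) ⟩
  0ℤ + sumL (allFinL v) (h ∘ suc)           ≡⟨ +-identityˡ _ ⟩
  sumL (allFinL v) (h ∘ suc)                ≡⟨ sum-single-point p (h ∘ suc) (λ a a≢p → off-p (suc a) (a≢p ∘ suc-injective)) ⟩
  h (suc p)                                 ∎

sum-two-points : {w : ℕ} (p : Fin (suc w)) (h : Fin (suc w) → ℤ) → p ≢ zero →
  (∀ a → a ≢ zero → a ≢ p → h a ≡ 0ℤ) → sumL (allFinL (suc w)) h ≡ h zero + h p
sum-two-points zero    h p≢0 off = contradiction refl p≢0
sum-two-points (suc c) h _   off =
  trans (sum-allFin-suc h)
        (cong (h zero +_) (sum-single-point c (h ∘ suc)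
                             (λ a a≢c → off (suc a) (λ ()) (a≢c ∘ suc-injective))))

sum-allTuples-suc : {v k : ℕ} (g : Tuple v (suc k) → ℤ) →
  sumL (allTuples v (suc k)) g ≡ sumL (allFinL v) (λ a → sumL (allTuples v k) (g ∘ (a ∷_)))
sum-allTuples-suc {v} {k} g =
  trans (sumL-concatMap (λ a → map (a ∷_) (allTuples v k)) (allFinL v) g)
        (sumL-cong (allFinL v) (λ a → sumL-map (a ∷_) (allTuples v k) g))

sum-vanishes-on-fibres : {w k : ℕ} (i : Fin k) (g : Tuple (suc w) k → ℤ) →
  (∀ y → sumL (allFinL (suc w)) (λ a → g (y [ i ]≔ a)) ≡ 0ℤ) →
  sumL (allTuples (suc w) k) g ≡ 0ℤ
sum-vanishes-on-fibres {w} {suc k} zero g fibre≡0 = begin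
  sumL (allTuples (suc w) (suc k)) g
    ≡⟨ sum-allTuples-suc g ⟩
  sumL (allFinL (suc w)) (λ a → sumL (allTuples (suc w) k) (g ∘ (a ∷_)))
    ≡⟨ sumL-swap (allFinL (suc w)) (allTuples (suc w) k) (λ a ys → g (a ∷ ys)) ⟩
  sumL (allTuples (suc w) k) (λ ys → sumL (allFinL (suc w)) (λ a → g (a ∷ ys)))
    ≡⟨ sumL-vanishes (allTuples (suc w) k) (λ ys → fibre≡0 (zero ∷ ys)) ⟩
  0ℤ ∎
sum-vanishes-on-fibres {w} {suc k} (suc i) g fibre≡0 =
  trans (sum-allTuples-suc g)
        (sumL-vanishes (allFinL (suc w)) (λ a →
           sum-vanishes-on-fibres i (g ∘ (a ∷_)) (λ ys → fibre≡0 (a ∷ ys))))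

∣p∪q∣≤∣p∣+∣q∣ : {n : ℕ} (p q : Subset n) → ∣ p ∪ q ∣ ≤ ∣ p ∣ ℕ.+ ∣ q ∣
∣p∪q∣≤∣p∣+∣q∣ []            []            = z≤n
∣p∪q∣≤∣p∣+∣q∣ (outside ∷ p) (outside ∷ q) = ∣p∪q∣≤∣p∣+∣q∣ p q
∣p∪q∣≤∣p∣+∣q∣ (outside ∷ p) (inside  ∷ q) =
  ≤-trans (s≤s (∣p∪q∣≤∣p∣+∣q∣ p q)) (≤-reflexive (sym (+-suc ∣ p ∣ ∣ q ∣)))
∣p∪q∣≤∣p∣+∣q∣ (inside  ∷ p) (outside ∷ q) = s≤s (∣p∪q∣≤∣p∣+∣q∣ p q)
∣p∪q∣≤∣p∣+∣q∣ (inside  ∷ p) (inside  ∷ q) =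
  s≤s (≤-trans (m≤n⇒m≤1+n (∣p∪q∣≤∣p∣+∣q∣ p q)) (≤-reflexive (sym (+-suc ∣ p ∣ ∣ q ∣))))

image : {t n : ℕ} → (Fin t → Fin n) → Subset n
image {ℕ.zero}  ι = ∅
image {suc t}   ι = ⁅ ι zero ⁆ ∪ image (ι ∘ suc)

∈-image : {t n : ℕ} (ι : Fin t → Fin n) (j : Fin t) → ι j ∈ image ι
∈-image ι zero    = x∈p∪q⁺ (inj₁ (x∈⁅x⁆ (ι zero)))
∈-image ι (suc j) = x∈p∪q⁺ (inj₂ (∈-image (ι ∘ suc) j))

∣image∣≤ : {t n : ℕ} (ι : Fin t → Fin n) → ∣ image ι ∣ ≤ t
∣image∣≤ {ℕ.zero} {n} ι = ≤-reflexive (∣⊥∣≡0 n)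
∣image∣≤ {suc t}     ι =
  ≤-trans (∣p∪q∣≤∣p∣+∣q∣ ⁅ ι zero ⁆ (image (ι ∘ suc)))
          (+-mono-≤ (≤-reflexive (∣⁅x⁆∣≡1 (ι zero))) (∣image∣≤ (ι ∘ suc)))

support : {A : Set} {P : A → Set} {n : ℕ} → Decidable P → Vec A n → Subset n
support P? []       = []
support P? (a ∷ xs) = does (P? a) ∷ support P? xs

∣support∣≡count : {A : Set} {P : A → Set} {n : ℕ} (P? : Decidable P) (xs : Vec A n) →
  ∣ support P? xs ∣ ≡ count P? xs
∣support∣≡count P? []       = refl
∣support∣≡count P? (a ∷ xs) with does (P? a)
... | true  = cong suc (∣support∣≡count P? xs)
... | false = ∣support∣≡count P? xs

∈-support : {A : Set} {P : A → Set} {n : ℕ} (P? : Decidable P) (xs : Vec A n) (i : Fin n) →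
  i ∈ support P? xs → P (lookup xs i)
∈-support P? (a ∷ xs) zero    i∈ with P? a
... | yes Pa = Pa
∈-support P? (a ∷ xs) zero () | no _
∈-support P? (a ∷ xs) (suc i) (there i∈) = ∈-support P? xs i i∈

larger-subset-escapes : {n : ℕ} (p q : Subset n) → ∣ q ∣ < ∣ p ∣ → ∃ λ i → i ∈ p × i ∉ q
larger-subset-escapes p q ∣q∣<∣p∣ with any? (λ i → (i ∈? p) ×-dec ¬? (i ∈? q))
... | yes escaping = escaping
... | no none      = contradiction (p⊆q⇒∣p∣≤∣q∣ p⊆q) (<⇒≱ ∣q∣<∣p∣)
  where
  p⊆q : p ⊆ q
  p⊆q {i} i∈p = decidable-stable (i ∈? q) (λ i∉q → none (i , i∈p , i∉q))

nonzero? : {w : ℕ} → Decidable (λ (a : V (suc w)) → a ≢ zero)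
nonzero? a = ¬? (a ≟ zero)

free-coordinate : {w k t : ℕ} (x : Tuple (suc w) k) (ι : Fin t → Fin k) → t < L x →
  ∃ λ i → lookup x i ≢ zero × (∀ j → ι j ≢ i)
free-coordinate x ι t<Lx
  with larger-subset-escapes (support nonzero? x) (image ι)
         (≤-<-trans (∣image∣≤ ι) (subst (_ <_) (sym (∣support∣≡count nonzero? x)) t<Lx))
... | i , i∈supp , i∉img =
  i , ∈-support nonzero? x i i∈supp ,
  λ j ιj≡i → i∉img (subst (_∈ image ι) ιj≡i (∈-image ι j))

update-elsewhere : {A : Set} {k : ℕ} (y : Vec A k) {i j : Fin k} {a b : A} → j ≢ i →
  lookup (y [ i ]≔ a) j ≡ lookup (y [ i ]≔ b) j
update-elsewhere y j≢i = trans (lookup∘update′ j≢i y _) (sym (lookup∘update′ j≢i y _))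

∈F-update : {w k : ℕ} (x y : Tuple (suc w) k) (i : Fin k) {a b : V (suc w)} →
  (a ≡ zero) ⊎ (a ≡ lookup x i) → (y [ i ]≔ b) ∈F x → (y [ i ]≔ a) ∈F x
∈F-update x y i {a} allowed yb∈F j with j ≟ i
... | yes refl = subst (λ z → (z ≡ zero) ⊎ (z ≡ lookup x i)) (sym (lookup∘update i y a)) allowed
... | no j≢i   = subst (λ z → (z ≡ zero) ⊎ (z ≡ lookup x j)) (update-elsewhere y j≢i) (yb∈F j)

∉F-update : {w k : ℕ} (x y : Tuple (suc w) k) (i : Fin k) {a : V (suc w)} →
  a ≢ zero → a ≢ lookup x i → ¬ (y [ i ]≔ a) ∈F x
∉F-update x y i {a} a≢0 a≢xᵢ ya∈F =
  [ a≢0 ∘ trans (sym (lookup∘update i y a)) , a≢xᵢ ∘ trans (sym (lookup∘update i y a)) ] (ya∈F i)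

∈Row-update : {w k t : ℕ} (r : Row (suc w) k t) (y : Tuple (suc w) k) {i : Fin k} {a b : V (suc w)} →
  (∀ j → ι r j ≢ i) → r ∈Row (y [ i ]≔ b) → r ∈Row (y [ i ]≔ a)
∈Row-update r y i∉I r∈yb j = trans (r∈yb j) (update-elsewhere y (i∉I j))

L-update : {w k : ℕ} (y : Tuple (suc w) k) (i : Fin k) {a : V (suc w)} →
  a ≢ zero → L (y [ i ]≔ a) ≡ suc (L (y [ i ]≔ zero))
L-update (b ∷ ys) zero {a} a≢0 with a ≟ zero
... | yes a≡0 = contradiction a≡0 a≢0
... | no _    = refl
L-update (b ∷ ys) (suc i) a≢0 with does (nonzero? b)
... | true  = cong suc (L-update ys i a≢0)
... | false = L-update ys i a≢0

weighted : Bool → ℕ → ℤ → ℤ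
weighted b n c = if b then (-1ℤ ^ n) * c else 0ℤ

weighted-cong : {b b′ : Bool} {n n′ : ℕ} {c c′ : ℤ} →
  b ≡ b′ → n ≡ n′ → c ≡ c′ → weighted b n c ≡ weighted b′ n′ c′
weighted-cong refl refl refl = refl

weighted-opposite : (b : Bool) (n : ℕ) (c : ℤ) → weighted b n c + weighted b (suc n) c ≡ 0ℤ
weighted-opposite false n c = refl
weighted-opposite true  n c = begin
  s * c + (-1ℤ * s) * c   ≡⟨ cong (λ z → s * c + z * c) (-1*i≡-i s) ⟩
  s * c + (- s) * c       ≡⟨ cong (s * c +_) (sym (neg-distribˡ-* s c)) ⟩
  s * c + - (s * c)       ≡⟨ +-inverseʳ (s * c) ⟩
  0ℤ                      ∎
  where s = -1ℤ ^ n

signedTerm : {w k t : ℕ} → Tuple (suc w) k → Row (suc w) k t → Tuple (suc w) k → ℤ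
signedTerm x r y = weighted (does (y ∈F? x)) (L y) (C y r)

pair-cancels : {w k t : ℕ} (x : Tuple (suc w) k) (r : Row (suc w) k t) (i : Fin k) →
  lookup x i ≢ zero → (∀ j → ι r j ≢ i) → (y : Tuple (suc w) k) →
  signedTerm x r (y [ i ]≔ zero) + signedTerm x r (y [ i ]≔ lookup x i) ≡ 0ℤ
pair-cancels x r i xᵢ≢0 i∉I y = begin
  signedTerm x r y₀ + signedTerm x r y₁
    ≡⟨ cong (signedTerm x r y₀ +_) (weighted-cong same-F (L-update y i xᵢ≢0) same-C) ⟩
  weighted (does (y₀ ∈F? x)) (L y₀) (C y₀ r) + weighted (does (y₀ ∈F? x)) (suc (L y₀)) (C y₀ r)
    ≡⟨ weighted-opposite (does (y₀ ∈F? x)) (L y₀) (C y₀ r) ⟩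
  0ℤ ∎
  where
  y₀ = y [ i ]≔ zero
  y₁ = y [ i ]≔ lookup x i
  same-F : does (y₁ ∈F? x) ≡ does (y₀ ∈F? x)
  same-F = does-⇔ (mk⇔ (∈F-update x y i (inj₁ refl)) (∈F-update x y i (inj₂ refl))) (y₁ ∈F? x) (y₀ ∈F? x)
  same-C : C y₁ r ≡ C y₀ r
  same-C = cong (λ b → if b then 1ℤ else 0ℤ)
                (does-⇔ (mk⇔ (∈Row-update r y i∉I) (∈Row-update r y i∉I)) (r ∈Row? y₁) (r ∈Row? y₀))

fibre-vanishes : {w k t : ℕ} (x : Tuple (suc w) k) (r : Row (suc w) k t) (i : Fin k) →
  lookup x i ≢ zero → (∀ j → ι r j ≢ i) → (y : Tuple (suc w) k) →
  sumL (allFinL (suc w)) (λ a → signedTerm x r (y [ i ]≔ a)) ≡ 0ℤ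
fibre-vanishes x r i xᵢ≢0 i∉I y =
  trans (sum-two-points (lookup x i) (λ a → signedTerm x r (y [ i ]≔ a)) xᵢ≢0 outside-pair)
        (pair-cancels x r i xᵢ≢0 i∉I y)
  where
  outside-pair : ∀ a → a ≢ zero → a ≢ lookup x i → signedTerm x r (y [ i ]≔ a) ≡ 0ℤ
  outside-pair a a≢0 a≢xᵢ =
    cong (λ b → weighted b (L (y [ i ]≔ a)) (C (y [ i ]≔ a) r))
         (dec-false ((y [ i ]≔ a) ∈F? x) (∉F-update x y i a≢0 a≢xᵢ))

lemma4 : (w k t : ℕ) → 1 ≤ k → t ≤ k →
    (x : Tuple (suc w) k) → t < L x →
    (r : Row (suc w) k t) → signedSumF w k t x r ≡ 0ℤ
lemma4 w k t _ _ x t<Lx r with free-coordinate x (ι r) t<Lx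
... | i , xᵢ≢0 , i∉I =
  sum-vanishes-on-fibres i (signedTerm x r) (fibre-vanishes x r i xᵢ≢0 i∉I)
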